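{- Let $k\geq 3$ and let $Q$ be a $k$-uniform hypergraph on $\ell$ vertices that is edge-degenerate or a linear cycle. Then every $\ell$-full $k$-uniform hypergraph with at least one edge contains a copy of $Q$.
   Context: A $k$-uniform hypergraph $G$ is $\ell$-full if every $(k-1)$-element subset of $V(G)$ is contained in either no edge or at least $\ell$ edges of $G$. A hypergraph $H$ is edge-degenerate if its edges can be ordered $e_1,\dots,e_m$ such that for every $i\in\{2,\dots,m\}$ there is $j\in\{1,\dots,i-1\}$ with $e_i\cap\bigcup_{r=1}^{i-1}e_r\subseteq e_j$. A $k$-uniform linear cycle consists of edges cyclically ordered such that consecutive edges share exactly one vertex, non-consecutive edges are disjoint, and every vertex lies in at most two edges. -}

module Defs where

open import Data.Nat using (ℕ; zero; suc; _∸_; _<_; _≥_)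
open import Data.Fin using (Fin; toℕ)
open import Data.Fin.Subset using (Subset; _∈_; _⊆_; ∣_∣)
open import Data.Product using (Σ; _×_; ∃; ∃-syntax; _,_)
open import Data.Sum using (_⊎_)
open import Data.Empty using (⊥)
open import Relation.Binary.PropositionalEquality using (_≡_; _≢_)
open import Function.Bundles using (_⇔_)

-- A hypergraph on vertex set Fin n: a predicate on subsets of Fin n
-- singling out the edges (the edge set is automatically finite).
record Hypergraph (n : ℕ) : Set₁ where
  field
    Edge : Subset n → Set
open Hypergraph public

Uniform : ∀ {n} → ℕ → Hypergraph n → Set
Uniform k H = ∀ e → Edge H e → ∣ e ∣ ≡ k

-- "at least ℓ edges contain S": there are ℓ pairwise distinct edges containing S.
AtLeastEdgesContaining : ∀ {n} → ℕ → Hypergraph n → Subset n → Set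
AtLeastEdgesContaining {n} ℓ H S =
  Σ (Fin ℓ → Subset n) λ f →
    (∀ i j → f i ≡ f j → i ≡ j) × (∀ i → Edge H (f i) × S ⊆ f i)

NoEdgeContaining : ∀ {n} → Hypergraph n → Subset n → Set
NoEdgeContaining H S = ∀ e → Edge H e → S ⊆ e → ⊥

Full : ∀ {n} → (k ℓ : ℕ) → Hypergraph n → Set
Full k ℓ H = ∀ S → ∣ S ∣ ≡ k ∸ 1 →
  NoEdgeContaining H S ⊎ AtLeastEdgesContaining ℓ H S

HasEdge : ∀ {n} → Hypergraph n → Set
HasEdge H = ∃[ e ] Edge H e

EdgeEnumeration : ∀ {n} → Hypergraph n → (m : ℕ) → (Fin m → Subset n) → Set
EdgeEnumeration H m f =
  (∀ i j → f i ≡ f j → i ≡ j) × (∀ i → Edge H (f i)) × (∀ e → Edge H e → ∃[ i ] f i ≡ e)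

EdgeDegenerate : ∀ {n} → Hypergraph n → Set
EdgeDegenerate {n} H =
  Σ ℕ λ m → Σ (Fin m → Subset n) λ f → EdgeEnumeration H m f ×
    (∀ (i : Fin m) → 1 Data.Nat.≤ toℕ i →
       ∃[ j ] (toℕ j < toℕ i ×
         (∀ x → x ∈ f i → (∃[ r ] (toℕ r < toℕ i × x ∈ f r)) → x ∈ f j)))

CycSucc : (m : ℕ) → Fin m → Fin m → Set
CycSucc m i j = (suc (toℕ i) ≡ toℕ j) ⊎ (suc (toℕ i) ≡ m × toℕ j ≡ 0)

Consecutive : (m : ℕ) → Fin m → Fin m → Set
Consecutive m i j = CycSucc m i j ⊎ CycSucc m j i

LinearCycle : ∀ {n} → Hypergraph n → Set
LinearCycle {n} H =
  Σ ℕ λ m → Σ (Fin m → Subset n) λ f → m ≥ 3 × EdgeEnumeration H m f ×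
    (∀ i j → Consecutive m i j →
       ∃[ x ] (x ∈ f i × x ∈ f j × (∀ y → y ∈ f i → y ∈ f j → y ≡ x))) ×
    (∀ i j → i ≢ j → (Consecutive m i j → ⊥) → ∀ x → x ∈ f i → x ∈ f j → ⊥) ×
    (∀ x i j r → x ∈ f i → x ∈ f j → x ∈ f r → (i ≡ j) ⊎ (j ≡ r) ⊎ (i ≡ r)) ×
    (∀ x → ∃[ i ] x ∈ f i)

ContainsCopy : ∀ {n ℓ} → Hypergraph n → Hypergraph ℓ → Set
ContainsCopy {n} {ℓ} G Q =
  Σ (Fin ℓ → Fin n) λ φ → (∀ a b → φ a ≡ φ b → a ≡ b) ×
    (∀ e → Edge Q e → ∃[ f ] (Edge G f × (∀ x → x ∈ f ⇔ (∃[ a ] (a ∈ e × φ a ≡ x)))))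

{-# OPTIONS --safe #-}
module Submission where

-- Q is embedded greedily, one vertex at a time. While an edge e of Q is being embedded we keep an
-- edge f of G through the images Z of the vertices of e placed so far. As ∣ Z ∣ < k, some vertex
-- c of f lies outside Z; the (k-1)-set f - c lies in an edge, hence by ℓ-fullness in ℓ edges, and
-- their ℓ extra vertices are pairwise distinct, so one of them avoids the fewer than ℓ vertices
-- already used. Mapping the next vertex of e there keeps an edge through the images, and once all
-- of e is mapped its k images fill that k-edge.
--
-- For an edge-degenerate ordering the placed part of e_i lies in an earlier e_j, whose image is the
-- edge to start from. A linear cycle e_0, …, e_m₁ is embedded in order as well, but the vertex
-- shared by e_i and e_(i+1) is placed first, inside an edge that also contains the image of the
-- pivot, the vertex shared by e_m₁ and e_0. The closing edge e_m₁ meets the earlier edges only in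
-- the pivot and in the vertex it shares with e_(m₁-1), so the last such edge is where its embedding
-- starts. Vertices of Q in no edge are placed last.

open import Defs
open import Data.Nat using (ℕ; zero; suc; _+_; _≤_; _<_; _≥_; _∸_; z≤n; s≤s)
open import Data.Nat.Properties
  using ( ≤-refl; ≤-trans; ≤-reflexive; ≤-antisym; <-irrefl; <-asym; <-trans; <⇒≱; <⇒≤
        ; <-≤-trans; ≤-<-trans; +-suc; +-monoʳ-≤; n≤1+n; n<1+n; suc-injective; m<1+n⇒m<n∨m≡n; m<n⇒0<n)
  renaming (_≟_ to _ℕ≟_)
open import Data.Fin using (Fin; zero; suc; toℕ; fromℕ<)
open import Data.Fin.Properties using (_≟_; any?; toℕ-fromℕ<; toℕ-injective; toℕ<n)
import Data.Fin.Properties as Fin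
open import Data.Fin.Subset
open import Data.Fin.Subset.Properties
open import Data.Vec.Base using ([]; _∷_; here; there)
open import Data.Vec.Functional using (updateAt)
open import Data.Vec.Functional.Properties using (updateAt-updates; updateAt-minimal)
open import Data.Product using (Σ; _×_; ∃-syntax; _,_; proj₁; proj₂)
open import Data.Sum using (_⊎_; inj₁; inj₂; [_,_])
import Data.Sum as Sum
open import Data.Empty using (⊥-elim) renaming (⊥ to ⊥₀)
open import Data.Unit using (tt) renaming (⊤ to ⊤₀)
open import Data.List using (List; []; _∷_; allFin)
import Data.List.Relation.Unary.Any as Any
open import Data.List.Membership.Propositional using () renaming (_∈_ to _∈ₗ_)
open import Data.List.Membership.Propositional.Properties using (∈-allFin)
open import Function using (_∘_; const; id; case_of_)
open import Function.Bundles using (_⇔_; mk⇔)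
open import Relation.Nullary using (¬_; yes; no; contradiction)
open import Relation.Nullary.Decidable using (_×-dec_; ¬?; decidable-stable)
open import Relation.Binary.PropositionalEquality
  using (_≡_; _≢_; refl; sym; trans; cong; cong₂; subst; subst₂)

private
  variable
    m n : ℕ
    p q : Subset n
    x y z : Fin n

∣p∪q∣≤∣p∣+∣q∣ : ∀ (p q : Subset n) → ∣ p ∪ q ∣ ≤ ∣ p ∣ + ∣ q ∣
∣p∪q∣≤∣p∣+∣q∣ []            []            = z≤n
∣p∪q∣≤∣p∣+∣q∣ (outside ∷ p) (outside ∷ q) = ∣p∪q∣≤∣p∣+∣q∣ p q
∣p∪q∣≤∣p∣+∣q∣ (outside ∷ p) (inside  ∷ q) =
  ≤-trans (s≤s (∣p∪q∣≤∣p∣+∣q∣ p q)) (≤-reflexive (sym (+-suc ∣ p ∣ ∣ q ∣)))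
∣p∪q∣≤∣p∣+∣q∣ (inside  ∷ p) (outside ∷ q) = s≤s (∣p∪q∣≤∣p∣+∣q∣ p q)
∣p∪q∣≤∣p∣+∣q∣ (inside  ∷ p) (inside  ∷ q) =
  s≤s (≤-trans (∣p∪q∣≤∣p∣+∣q∣ p q) (+-monoʳ-≤ ∣ p ∣ (n≤1+n ∣ q ∣)))

∣p∣<∣q∣⇒q⊈p : ∣ p ∣ < ∣ q ∣ → ∃[ x ] x ∈ q × x ∉ p
∣p∣<∣q∣⇒q⊈p {p = p} {q} ∣p∣<∣q∣ with any? (λ x → x ∈? q ×-dec ¬? (x ∈? p))
... | yes witness = witness
... | no none     = contradiction (p⊆q⇒∣p∣≤∣q∣ q⊆p) (<⇒≱ ∣p∣<∣q∣)
  where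
  q⊆p : q ⊆ p
  q⊆p {x} x∈q = decidable-stable (x ∈? p) λ x∉p → none (x , x∈q , x∉p)

p⊆q∧∣q∣≤∣p∣⇒p≡q : p ⊆ q → ∣ q ∣ ≤ ∣ p ∣ → p ≡ q
p⊆q∧∣q∣≤∣p∣⇒p≡q {p = p} {q} p⊆q ∣q∣≤∣p∣ = ⊆-antisym p⊆q q⊆p
  where
  q⊆p : q ⊆ p
  q⊆p {x} x∈q = decidable-stable (x ∈? p) λ x∉p →
    <⇒≱ (p⊂q⇒∣p∣<∣q∣ (p⊆q , x , x∈q , x∉p)) ∣q∣≤∣p∣

x∉p⇒∣p∣<n : ∀ {p : Subset n} → x ∉ p → ∣ p ∣ < n
x∉p⇒∣p∣<n {n = n} {x = x} x∉p = <-≤-trans (p⊂q⇒∣p∣<∣q∣ (⊆⊤ , x , ∈⊤ , x∉p)) (≤-reflexive (∣⊤∣≡n n))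

x∈p⇒∣p∣≡1+∣p-x∣ : x ∈ p → ∣ p ∣ ≡ suc ∣ p - x ∣
x∈p⇒∣p∣≡1+∣p-x∣ {x = x} {p} x∈p = ≤-antisym ∣p∣≤1+∣p-x∣ (x∈p⇒∣p-x∣<∣p∣ x∈p)
  where
  p⊆x∪p-x : p ⊆ ⁅ x ⁆ ∪ (p - x)
  p⊆x∪p-x {y} y∈p with y ≟ x
  ... | yes refl = x∈p∪q⁺ (inj₁ (x∈⁅x⁆ x))
  ... | no  y≢x  = x∈p∪q⁺ (inj₂ (x∈p∧x≢y⇒x∈p-y y∈p y≢x))
  ∣p∣≤1+∣p-x∣ : ∣ p ∣ ≤ suc ∣ p - x ∣
  ∣p∣≤1+∣p-x∣ = ≤-trans (p⊆q⇒∣p∣≤∣q∣ p⊆x∪p-x)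
    (≤-trans (∣p∪q∣≤∣p∣+∣q∣ ⁅ x ⁆ (p - x)) (≤-reflexive (cong (_+ ∣ p - x ∣) (∣⁅x⁆∣≡1 x))))

q∖p-unique : p ⊆ q → ∣ q ∣ ≡ suc ∣ p ∣ → y ∈ q → y ∉ p → z ∈ q → z ∉ p → y ≡ z
q∖p-unique {p = p} {q} {y} {z} p⊆q ∣q∣≡1+∣p∣ y∈q y∉p z∈q z∉p = decidable-stable (y ≟ z) λ y≢z →
  <-irrefl (suc-injective (trans (sym ∣q∣≡1+∣p∣) (x∈p⇒∣p∣≡1+∣p-x∣ y∈q)))
    (p⊂q⇒∣p∣<∣q∣ (p⊆q-y , z , x∈p∧x≢y⇒x∈p-y z∈q (y≢z ∘ sym) , z∉p))
  where
  p⊆q-y : p ⊆ q - y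
  p⊆q-y {a} a∈p = x∈p∧x≢y⇒x∈p-y (p⊆q a∈p) λ { refl → y∉p a∈p }

one-point-extension-⊆ : ∀ {r : Subset n} →
  p ⊆ q → ∣ q ∣ ≡ suc ∣ p ∣ → x ∈ q → x ∉ p → p ⊆ r → x ∈ r → q ⊆ r
one-point-extension-⊆ {p = p} {x = x} {r} p⊆q ∣q∣≡1+∣p∣ x∈q x∉p p⊆r x∈r {y} y∈q with y ∈? p
... | yes y∈p = p⊆r y∈p
... | no  y∉p = subst (_∈ r) (q∖p-unique p⊆q ∣q∣≡1+∣p∣ x∈q x∉p y∈q y∉p) x∈r

p∪⁅x⁆⊆p∪q : x ∈ q → p ∪ ⁅ x ⁆ ⊆ p ∪ q
p∪⁅x⁆⊆p∪q {x = x} {q} {p} x∈q a∈ with x∈p∪q⁻ p ⁅ x ⁆ a∈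
... | inj₁ a∈p   = p⊆p∪q q a∈p
... | inj₂ a∈⁅x⁆ = subst (_∈ p ∪ q) (sym (x∈⁅y⁆⇒x≡y x a∈⁅x⁆)) (q⊆p∪q p q x∈q)

∈⁅x⁆∪⁅y⁆⁻ : z ∈ ⁅ x ⁆ ∪ ⁅ y ⁆ → z ≡ x ⊎ z ≡ y
∈⁅x⁆∪⁅y⁆⁻ {x = x} {y} z∈ = Sum.map (x∈⁅y⁆⇒x≡y x) (x∈⁅y⁆⇒x≡y y) (x∈p∪q⁻ ⁅ x ⁆ ⁅ y ⁆ z∈)

InjectiveOn : (Fin m → Fin n) → Subset m → Set
InjectiveOn φ p = ∀ {x y} → x ∈ p → y ∈ p → φ x ≡ φ y → x ≡ y

InjectiveOn-tail : ∀ {φ : Fin (suc m) → Fin n} {b} → InjectiveOn φ (b ∷ p) → InjectiveOn (φ ∘ suc) p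
InjectiveOn-tail inj x∈p y∈p = Fin.suc-injective ∘ inj (there x∈p) (there y∈p)

image : (Fin m → Fin n) → Subset m → Subset n
image φ []            = ⊥
image φ (outside ∷ p) = image (φ ∘ suc) p
image φ (inside  ∷ p) = ⁅ φ zero ⁆ ∪ image (φ ∘ suc) p

∈-image⁺ : ∀ (φ : Fin m → Fin n) → x ∈ p → φ x ∈ image φ p
∈-image⁺ {p = inside  ∷ p} φ here        = x∈p∪q⁺ (inj₁ (x∈⁅x⁆ (φ zero)))
∈-image⁺ {p = outside ∷ p} φ (there x∈p) = ∈-image⁺ (φ ∘ suc) x∈p
∈-image⁺ {p = inside  ∷ p} φ (there x∈p) = x∈p∪q⁺ (inj₂ (∈-image⁺ (φ ∘ suc) x∈p))

∈-image⁻ : ∀ (φ : Fin m → Fin n) (p : Subset m) → y ∈ image φ p → ∃[ x ] x ∈ p × φ x ≡ y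
∈-image⁻ φ []            y∈⊥ = contradiction y∈⊥ ∉⊥
∈-image⁻ φ (outside ∷ p) y∈ with ∈-image⁻ (φ ∘ suc) p y∈
... | x , x∈p , φx≡y = suc x , there x∈p , φx≡y
∈-image⁻ φ (inside  ∷ p) y∈ with x∈p∪q⁻ ⁅ φ zero ⁆ (image (φ ∘ suc) p) y∈
... | inj₁ y∈⁅φ0⁆ = zero , here , sym (x∈⁅y⁆⇒x≡y (φ zero) y∈⁅φ0⁆)
... | inj₂ y∈     with ∈-image⁻ (φ ∘ suc) p y∈
...   | x , x∈p , φx≡y = suc x , there x∈p , φx≡y

∣image∣≤∣p∣ : ∀ (φ : Fin m → Fin n) (p : Subset m) → ∣ image φ p ∣ ≤ ∣ p ∣
∣image∣≤∣p∣ {n = n} φ []    = ≤-reflexive (∣⊥∣≡0 n)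
∣image∣≤∣p∣ φ (outside ∷ p) = ∣image∣≤∣p∣ (φ ∘ suc) p
∣image∣≤∣p∣ φ (inside  ∷ p) = ≤-trans (∣p∪q∣≤∣p∣+∣q∣ ⁅ φ zero ⁆ (image (φ ∘ suc) p))
  (≤-trans (≤-reflexive (cong (_+ ∣ image (φ ∘ suc) p ∣) (∣⁅x⁆∣≡1 (φ zero))))
           (s≤s (∣image∣≤∣p∣ (φ ∘ suc) p)))

∣p∣≤∣image∣ : ∀ (φ : Fin m → Fin n) (p : Subset m) → InjectiveOn φ p → ∣ p ∣ ≤ ∣ image φ p ∣
∣p∣≤∣image∣ φ []            _   = z≤n
∣p∣≤∣image∣ φ (outside ∷ p) inj = ∣p∣≤∣image∣ (φ ∘ suc) p (InjectiveOn-tail inj)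
∣p∣≤∣image∣ φ (inside  ∷ p) inj = ≤-trans (s≤s (∣p∣≤∣image∣ (φ ∘ suc) p (InjectiveOn-tail inj)))
  (p⊂q⇒∣p∣<∣q∣ (q⊆p∪q ⁅ φ zero ⁆ rest , φ zero , x∈p∪q⁺ (inj₁ (x∈⁅x⁆ (φ zero))) , φ0∉rest))
  where
  rest : Subset _
  rest = image (φ ∘ suc) p
  φ0∉rest : φ zero ∉ rest
  φ0∉rest φ0∈ with ∈-image⁻ (φ ∘ suc) p φ0∈
  ... | x , x∈p , φ1+x≡φ0 with inj (there x∈p) here φ1+x≡φ0
  ... | ()

image-cong : ∀ {φ ψ : Fin m → Fin n} (p : Subset m) → (∀ {x} → x ∈ p → φ x ≡ ψ x) → image φ p ≡ image ψ p
image-cong []            _   = refl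
image-cong (outside ∷ p) φ≗ψ = image-cong p (φ≗ψ ∘ there)
image-cong (inside  ∷ p) φ≗ψ = cong₂ (λ a r → ⁅ a ⁆ ∪ r) (φ≗ψ here) (image-cong p (φ≗ψ ∘ there))

-- Extending edges of a full hypergraph

module _ (G : Hypergraph n) where

  ExtensionAvoiding : Subset n → Subset n → Set
  ExtensionAvoiding Z Y = ∃[ g ] Edge G g × Z ⊆ g × ∃[ w ] w ∈ g × w ∉ Y

  -- The ℓ edges through S add ℓ distinct vertices to S, so they cannot all land in Y.
  avoiding-extension : ∀ {ℓ} (S Y : Subset n) → Uniform (suc ∣ S ∣) G → AtLeastEdgesContaining ℓ G S →
                       ∣ Y ∣ < ℓ → ExtensionAvoiding S Y
  avoiding-extension {ℓ} S Y uniform (g , g-injective , g-edge) ∣Y∣<ℓ = pick (∣p∣<∣q∣⇒q⊈p ∣Y∣<∣image∣)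
    where
    ∣g∣≡1+∣S∣ : ∀ i → ∣ g i ∣ ≡ suc ∣ S ∣
    ∣g∣≡1+∣S∣ i = uniform (g i) (proj₁ (g-edge i))
    extra : ∀ i → ∃[ v ] v ∈ g i × v ∉ S
    extra i = ∣p∣<∣q∣⇒q⊈p (≤-reflexive (sym (∣g∣≡1+∣S∣ i)))
    v : Fin ℓ → Fin n
    v i = proj₁ (extra i)
    v∈g : ∀ i → v i ∈ g i
    v∈g i = proj₁ (proj₂ (extra i))
    g-⊆ : ∀ i j → v i ≡ v j → g i ⊆ g j
    g-⊆ i j vᵢ≡vⱼ = one-point-extension-⊆ (proj₂ (g-edge i)) (∣g∣≡1+∣S∣ i) (v∈g i) (proj₂ (proj₂ (extra i)))
                                          (proj₂ (g-edge j)) (subst (_∈ g j) (sym vᵢ≡vⱼ) (v∈g j))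
    v-injective : InjectiveOn v ⊤
    v-injective {i} {j} _ _ vᵢ≡vⱼ = g-injective i j (⊆-antisym (g-⊆ i j vᵢ≡vⱼ) (g-⊆ j i (sym vᵢ≡vⱼ)))
    ∣Y∣<∣image∣ : ∣ Y ∣ < ∣ image v ⊤ ∣
    ∣Y∣<∣image∣ = <-≤-trans ∣Y∣<ℓ (≤-trans (≤-reflexive (sym (∣⊤∣≡n ℓ))) (∣p∣≤∣image∣ v ⊤ v-injective))
    pick : ∃[ w ] w ∈ image v ⊤ × w ∉ Y → ExtensionAvoiding S Y
    pick (w , w∈image , w∉Y) with ∈-image⁻ v ⊤ w∈image
    ... | i , _ , vᵢ≡w = g i , proj₁ (g-edge i) , proj₂ (g-edge i) , w , subst (_∈ g i) vᵢ≡w (v∈g i) , w∉Y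

  module _ {k ℓ : ℕ} (uniform : Uniform k G) (full : Full k ℓ G) where

    exchange : ∀ {f c} (Y : Subset n) → Edge G f → c ∈ f → ∣ Y ∣ < ℓ → ExtensionAvoiding (f - c) Y
    exchange {f} {c} Y f-edge c∈f ∣Y∣<ℓ = through (full (f - c) (sym (cong (_∸ 1) k≡1+∣f-c∣)))
      where
      k≡1+∣f-c∣ : k ≡ suc ∣ f - c ∣
      k≡1+∣f-c∣ = trans (sym (uniform f f-edge)) (x∈p⇒∣p∣≡1+∣p-x∣ c∈f)
      through : NoEdgeContaining G (f - c) ⊎ AtLeastEdgesContaining ℓ G (f - c) → ExtensionAvoiding (f - c) Y
      through (inj₁ none) = ⊥-elim (none f f-edge (p─q⊆p f ⁅ c ⁆))
      through (inj₂ many) =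
        avoiding-extension (f - c) Y (subst (λ j → Uniform j G) k≡1+∣f-c∣ uniform) many ∣Y∣<ℓ

    grow-edge : ∀ {f} (Z Y : Subset n) → Edge G f → Z ⊆ f → ∣ Z ∣ < k → ∣ Y ∣ < ℓ → ExtensionAvoiding Z Y
    grow-edge {f} Z Y f-edge Z⊆f ∣Z∣<k ∣Y∣<ℓ
      with ∣p∣<∣q∣⇒q⊈p {p = Z} {q = f} (subst (∣ Z ∣ <_) (sym (uniform f f-edge)) ∣Z∣<k)
    ... | c , c∈f , c∉Z with exchange Y f-edge c∈f ∣Y∣<ℓ
    ...   | g , g-edge , f-c⊆g , new =
      g , g-edge , (λ z∈Z → f-c⊆g (x∈p∧x≢y⇒x∈p-y (Z⊆f z∈Z) λ { refl → c∉Z z∈Z })) , new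

-- Orderings of the edges of Q

Before : (Fin m → Subset n) → ℕ → Fin n → Set
Before f i a = ∃[ r ] toℕ r < i × a ∈ f r

DegenerateOrder : (Fin m → Subset n) → Set
DegenerateOrder {m} f =
  ∀ (i : Fin m) → 1 ≤ toℕ i → ∃[ j ] (toℕ j < toℕ i × (∀ x → x ∈ f i → Before f (toℕ i) x → x ∈ f j))

ConsecutiveShareOne : (Fin m → Subset n) → Set
ConsecutiveShareOne {m} f =
  ∀ i j → Consecutive m i j → ∃[ x ] (x ∈ f i × x ∈ f j × (∀ y → y ∈ f i → y ∈ f j → y ≡ x))

NonConsecutiveDisjoint : (Fin m → Subset n) → Set
NonConsecutiveDisjoint {m} f = ∀ i j → i ≢ j → (Consecutive m i j → ⊥₀) → ∀ x → x ∈ f i → x ∈ f j → ⊥₀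

AtMostTwoEdges : (Fin m → Subset n) → Set
AtMostTwoEdges f = ∀ x i j r → x ∈ f i → x ∈ f j → x ∈ f r → (i ≡ j) ⊎ (j ≡ r) ⊎ (i ≡ r)

module LinearCycleStructure {m₁ : ℕ} (2≤m₁ : 2 ≤ m₁) (f : Fin (suc m₁) → Subset n)
  (linear : ConsecutiveShareOne f) (disjoint : NonConsecutiveDisjoint f) (two-edges : AtMostTwoEdges f) where

  at : (i : ℕ) → .(i < suc m₁) → Fin (suc m₁)
  at i i<m = fromℕ< i<m

  at-< : ∀ {i j} (i<m : i < suc m₁) (j<m : j < suc m₁) → i < j → toℕ (at i i<m) < toℕ (at j j<m)
  at-< i<m j<m = subst₂ _<_ (sym (toℕ-fromℕ< i<m)) (sym (toℕ-fromℕ< j<m))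

  last : Fin (suc m₁)
  last = at m₁ ≤-refl

  private
    closing : ∃[ x ] (x ∈ f last × x ∈ f zero × (∀ y → y ∈ f last → y ∈ f zero → y ≡ x))
    closing = linear last zero (inj₁ (inj₂ (cong suc (toℕ-fromℕ< ≤-refl) , refl)))

  pivot : Fin n
  pivot = proj₁ closing

  pivot∈last : pivot ∈ f last
  pivot∈last = proj₁ (proj₂ closing)

  pivot∈first : pivot ∈ f zero
  pivot∈first = proj₁ (proj₂ (proj₂ closing))

  no-three : ∀ {x a b c} → toℕ a < toℕ b → toℕ b < toℕ c → x ∈ f a → x ∈ f b → x ∈ f c → ⊥₀
  no-three {x} {a} {b} {c} a<b b<c x∈a x∈b x∈c with two-edges x a b c x∈a x∈b x∈c
  ... | inj₁ refl        = <-irrefl refl a<b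
  ... | inj₂ (inj₁ refl) = <-irrefl refl b<c
  ... | inj₂ (inj₂ refl) = <-irrefl refl (<-trans a<b b<c)

  ¬consecutive : ∀ {r j} → suc (toℕ r) < toℕ j → ¬ (suc (toℕ j) ≡ suc m₁ × toℕ r ≡ 0) →
                 ¬ Consecutive (suc m₁) r j
  ¬consecutive r+1<j _     (inj₁ (inj₁ 1+r≡j))     = <-irrefl 1+r≡j r+1<j
  ¬consecutive r+1<j _     (inj₁ (inj₂ (_ , j≡0))) = contradiction (subst (_ <_) j≡0 r+1<j) λ ()
  ¬consecutive r+1<j _     (inj₂ (inj₁ 1+j≡r))     =
    <-asym (<-trans (n<1+n _) r+1<j) (subst (_ <_) 1+j≡r (n<1+n _))
  ¬consecutive _     ¬wrap (inj₂ (inj₂ wrap))      = ¬wrap wrap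

  far-apart : ∀ {a r j} → suc (toℕ r) < toℕ j → a ∈ f r → a ∈ f j → a ≡ pivot
  far-apart {a} {r} {j} r+1<j a∈r a∈j with suc (toℕ j) ℕ≟ suc m₁ ×-dec toℕ r ℕ≟ 0
  ... | yes (1+j≡m , r≡0) =
    proj₂ (proj₂ (proj₂ closing)) a (subst (λ i → a ∈ f i) j≡last a∈j)
                                    (subst (λ i → a ∈ f i) (toℕ-injective r≡0) a∈r)
    where
    j≡last : j ≡ last
    j≡last = toℕ-injective (trans (suc-injective 1+j≡m) (sym (toℕ-fromℕ< ≤-refl)))
  ... | no ¬wrap =
    ⊥-elim (disjoint r j (λ { refl → <-irrefl refl (<-trans (n<1+n _) r+1<j) }) (¬consecutive r+1<j ¬wrap)
                     a a∈r a∈j)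

  record Link (i : ℕ) (1+i<m : suc i < suc m₁) : Set where
    field
      shared        : Fin n
      shared∈this   : shared ∈ f (at i (<⇒≤ 1+i<m))
      shared∈next   : shared ∈ f (at (suc i) 1+i<m)
      shared-unique : ∀ {y} → y ∈ f (at i (<⇒≤ 1+i<m)) → y ∈ f (at (suc i) 1+i<m) → y ≡ shared

  link : ∀ i 1+i<m → Link i 1+i<m
  link i 1+i<m
    with linear (at i _) (at (suc i) 1+i<m)
                (inj₁ (inj₁ (trans (cong suc (toℕ-fromℕ< _)) (sym (toℕ-fromℕ< 1+i<m)))))
  ... | x , x∈this , x∈next , x-unique =
    record { shared = x ; shared∈this = x∈this ; shared∈next = x∈next ; shared-unique = x-unique _ }

  link-new : ∀ i 1+i<m → let x = Link.shared (link i 1+i<m) in x ≡ pivot ⊎ Before f i x → ⊥₀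
  link-new zero 1+i<m (inj₁ x≡pivot) =
    no-three {a = zero} {b = at 1 1+i<m} {c = last} (at-< (s≤s z≤n) 1+i<m (s≤s z≤n)) (at-< 1+i<m ≤-refl 2≤m₁)
      pivot∈first (subst (_∈ f _) x≡pivot (Link.shared∈next (link 0 1+i<m))) pivot∈last
  link-new (suc i) 1+i<m (inj₁ x≡pivot) =
    no-three {a = zero} {b = at (suc i) (<⇒≤ 1+i<m)} {c = at (suc (suc i)) 1+i<m}
      (at-< (s≤s z≤n) (<⇒≤ 1+i<m) (s≤s z≤n)) (at-< (<⇒≤ 1+i<m) 1+i<m (n<1+n (suc i))) pivot∈first
      (subst (_∈ f _) x≡pivot (Link.shared∈this (link (suc i) 1+i<m)))
      (subst (_∈ f _) x≡pivot (Link.shared∈next (link (suc i) 1+i<m)))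
  link-new i 1+i<m (inj₂ (r , r<i , x∈r)) =
    no-three {b = at i (<⇒≤ 1+i<m)} {c = at (suc i) 1+i<m}
      (subst (toℕ r <_) (sym (toℕ-fromℕ< (<⇒≤ 1+i<m))) r<i) (at-< (<⇒≤ 1+i<m) 1+i<m (n<1+n i))
      x∈r (Link.shared∈this (link i 1+i<m)) (Link.shared∈next (link i 1+i<m))

  link-meets-next : ∀ {a} i 1+i<m → a ∈ f (at (suc i) 1+i<m) → a ≡ pivot ⊎ Before f (suc i) a →
                    a ∈ ⁅ Link.shared (link i 1+i<m) ⁆ ∪ ⁅ pivot ⁆
  link-meets-next i 1+i<m a∈next (inj₁ refl) = x∈p∪q⁺ (inj₂ (x∈⁅x⁆ pivot))
  link-meets-next {a} i 1+i<m a∈next (inj₂ (r , r<1+i , a∈r)) with m<1+n⇒m<n∨m≡n r<1+i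
  ... | inj₁ r<i =
    subst (_∈ _) (sym (far-apart (subst (suc (toℕ r) <_) (sym (toℕ-fromℕ< 1+i<m)) (s≤s r<i)) a∈r a∈next))
                 (x∈p∪q⁺ (inj₂ (x∈⁅x⁆ pivot)))
  ... | inj₂ r≡i =
    subst (_∈ _) (sym (Link.shared-unique (link i 1+i<m) (subst (λ j → a ∈ f j) r≡this a∈r) a∈next))
                 (x∈p∪q⁺ (inj₁ (x∈⁅x⁆ _)))
    where
    r≡this : r ≡ at i (<⇒≤ 1+i<m)
    r≡this = toℕ-injective (trans r≡i (sym (toℕ-fromℕ< _)))

-- Partial embeddings

record PartialEmbedding (m n : ℕ) : Set where
  field
    dom       : Subset m
    φ         : Fin m → Fin n
    injective : InjectiveOn φ dom
open PartialEmbedding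

private
  variable
    s t u : PartialEmbedding m n
    A B e : Subset m
    g : Subset n
    a : Fin m
    w : Fin n

range : PartialEmbedding m n → Subset n
range s = image (φ s) (dom s)

∅-embedding : Fin n → PartialEmbedding m n
∅-embedding v = record { dom = ⊥ ; φ = const v ; injective = λ x∈⊥ _ _ → contradiction x∈⊥ ∉⊥ }

⁅_↦_⁆ : Fin m → Fin n → PartialEmbedding m n
⁅ x ↦ v ⁆ = record
  { dom       = ⁅ x ⁆
  ; φ         = const v
  ; injective = λ a∈ b∈ _ → trans (x∈⁅y⁆⇒x≡y x a∈) (sym (x∈⁅y⁆⇒x≡y x b∈))
  }

∉range⇒≢ : w ∉ range s → a ∈ dom s → φ s a ≢ w
∉range⇒≢ {s = s} w∉ a∈ φa≡w = w∉ (subst (_∈ range s) φa≡w (∈-image⁺ (φ s) a∈))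

module _ (s : PartialEmbedding m n) (x : Fin m) (w : Fin n) where

  updated-or-kept : a ∈ dom s ∪ ⁅ x ⁆ → a ≡ x ⊎ (a ∈ dom s × updateAt (φ s) x (const w) a ≡ φ s a)
  updated-or-kept {a} a∈ with a ≟ x | x∈p∪q⁻ (dom s) ⁅ x ⁆ a∈
  ... | yes a≡x | _          = inj₁ a≡x
  ... | no  a≢x | inj₁ a∈dom = inj₂ (a∈dom , updateAt-minimal a x (φ s) a≢x)
  ... | no  a≢x | inj₂ a∈⁅x⁆ = contradiction (x∈⁅y⁆⇒x≡y x a∈⁅x⁆) a≢x

  update-injective : w ∉ range s → InjectiveOn (updateAt (φ s) x (const w)) (dom s ∪ ⁅ x ⁆)
  update-injective w∉ a∈ b∈ eq with updated-or-kept a∈ | updated-or-kept b∈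
  ... | inj₁ refl             | inj₁ refl             = refl
  ... | inj₁ refl             | inj₂ (b∈dom , φ′b≡φb) =
    contradiction (trans (sym φ′b≡φb) (trans (sym eq) (updateAt-updates x (φ s)))) (∉range⇒≢ {s = s} w∉ b∈dom)
  ... | inj₂ (a∈dom , φ′a≡φa) | inj₁ refl             =
    contradiction (trans (sym φ′a≡φa) (trans eq (updateAt-updates x (φ s)))) (∉range⇒≢ {s = s} w∉ a∈dom)
  ... | inj₂ (a∈dom , φ′a≡φa) | inj₂ (b∈dom , φ′b≡φb) =
    injective s a∈dom b∈dom (trans (sym φ′a≡φa) (trans eq φ′b≡φb))

infixl 9 _[_↦_]⟨_⟩

_[_↦_]⟨_⟩ : (s : PartialEmbedding m n) (x : Fin m) (w : Fin n) → w ∉ range s → PartialEmbedding m n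
s [ x ↦ w ]⟨ w∉ ⟩ = record
  { dom       = dom s ∪ ⁅ x ⁆
  ; φ         = updateAt (φ s) x (const w)
  ; injective = update-injective s x w w∉
  }

infix 4 _⊑_

record _⊑_ (s t : PartialEmbedding m n) : Set where
  field
    dom-⊆    : dom s ⊆ dom t
    φ-agrees : ∀ {a} → a ∈ dom s → φ t a ≡ φ s a
open _⊑_

⊑-refl : s ⊑ s
⊑-refl = record { dom-⊆ = id ; φ-agrees = λ _ → refl }

⊑-trans : s ⊑ t → t ⊑ u → s ⊑ u
⊑-trans s⊑t t⊑u = record
  { dom-⊆    = λ a∈s → dom-⊆ t⊑u (dom-⊆ s⊑t a∈s)
  ; φ-agrees = λ a∈s → trans (φ-agrees t⊑u (dom-⊆ s⊑t a∈s)) (φ-agrees s⊑t a∈s)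
  }

⊑-↦ : ∀ {x} {w∉ : w ∉ range s} → x ∉ dom s → s ⊑ s [ x ↦ w ]⟨ w∉ ⟩
⊑-↦ {s = s} {x = x} x∉ = record
  { dom-⊆    = λ a∈ → x∈p∪q⁺ (inj₁ a∈)
  ; φ-agrees = λ {a} a∈ → updateAt-minimal a x (φ s) λ { refl → x∉ a∈ }
  }

Template : PartialEmbedding m n → Subset m → Subset n → Set
Template s A g = ∀ {a} → a ∈ A → a ∈ dom s → φ s a ∈ g

template-↦ : ∀ {X x} {w∉ : w ∉ range s} → Template s X g → w ∈ g → (∀ {a} → a ∈ B → a ∈ dom s → a ∈ X) →
             Template (s [ x ↦ w ]⟨ w∉ ⟩) B g
template-↦ {w = w} {s = s} {g = g} {x = x} template w∈g B⊆X a∈B a∈ with updated-or-kept s x w a∈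
... | inj₁ refl             = subst (_∈ g) (sym (updateAt-updates x (φ s))) w∈g
... | inj₂ (a∈dom , φ′a≡φa) = subst (_∈ g) (sym φ′a≡φa) (template (B⊆X a∈B a∈dom) a∈dom)

template-⊑ : s ⊑ t → (∀ {a} → a ∈ A → a ∈ dom t → a ∈ dom s) → Template s A g → Template t A g
template-⊑ {g = g} s⊑t back template a∈A a∈t =
  subst (_∈ g) (sym (φ-agrees s⊑t (back a∈A a∈t))) (template a∈A (back a∈A a∈t))

template⇒image⊆ : ∀ {s : PartialEmbedding m n} {X g} → Template s X g → image (φ s) (X ∩ dom s) ⊆ g
template⇒image⊆ {s = s} {X} template y∈ with ∈-image⁻ (φ s) (X ∩ dom s) y∈
... | a , a∈X∩dom , refl = template (proj₁ (x∈p∩q⁻ X (dom s) a∈X∩dom)) (proj₂ (x∈p∩q⁻ X (dom s) a∈X∩dom))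

template⇒image≡ : e ⊆ dom s → Template s e g → ∣ g ∣ ≤ ∣ e ∣ → image (φ s) e ≡ g
template⇒image≡ {e = e} {s = s} {g = g} e⊆dom template ∣g∣≤∣e∣ =
  p⊆q∧∣q∣≤∣p∣⇒p≡q image⊆g (≤-trans ∣g∣≤∣e∣ (∣p∣≤∣image∣ (φ s) e λ a∈ b∈ → injective s (e⊆dom a∈) (e⊆dom b∈)))
  where
  image⊆g : image (φ s) e ⊆ g
  image⊆g y∈ with ∈-image⁻ (φ s) e y∈
  ... | a , a∈e , refl = template a∈e (e⊆dom a∈e)

Embeds : Hypergraph n → PartialEmbedding m n → Subset m → Set
Embeds G s e = e ⊆ dom s × Edge G (image (φ s) e)

Embeds-⊑ : ∀ {G : Hypergraph n} → s ⊑ t → Embeds G s e → Embeds G t e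
Embeds-⊑ {e = e} {G = G} s⊑t (e⊆s , edge) =
  (λ a∈e → dom-⊆ s⊑t (e⊆s a∈e)) , subst (Edge G) (image-cong e λ a∈e → sym (φ-agrees s⊑t (e⊆s a∈e))) edge

-- Greedy embedding into a full hypergraph

module Embedding (G : Hypergraph n) {k ℓ : ℕ} (uniform : Uniform k G) (full : Full k ℓ G) where

  record Growth (s : PartialEmbedding ℓ n) (X : Subset ℓ) : Set where
    field
      vertex      : Fin n
      fresh       : vertex ∉ range s
      edge        : Subset n
      is-edge     : Edge G edge
      X-template  : Template s X edge
      vertex∈edge : vertex ∈ edge

  grow : ∀ {x} (s : PartialEmbedding ℓ n) (X : Subset ℓ) → x ∉ dom s → ∣ X ∩ dom s ∣ < k →
         Edge G g → Template s X g → Growth s X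
  grow s X x∉dom ∣X∩dom∣<k g-edge template
    with grow-edge G uniform full (image (φ s) (X ∩ dom s)) (range s) g-edge
                   (template⇒image⊆ {s = s} template)
                   (≤-<-trans (∣image∣≤∣p∣ (φ s) (X ∩ dom s)) ∣X∩dom∣<k)
                   (≤-<-trans (∣image∣≤∣p∣ (φ s) (dom s)) (x∉p⇒∣p∣<n x∉dom))
  ... | g′ , g′-edge , image⊆g′ , w , w∈g′ , w∉range = record
    { vertex      = w
    ; fresh       = w∉range
    ; edge        = g′
    ; is-edge     = g′-edge
    ; X-template  = λ a∈X a∈dom → image⊆g′ (∈-image⁺ (φ s) (x∈p∩q⁺ (a∈X , a∈dom)))
    ; vertex∈edge = w∈g′
    }

  record Extension (s : PartialEmbedding ℓ n) (A : Subset ℓ) (P : PartialEmbedding ℓ n → Set) : Set where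
    field
      target   : PartialEmbedding ℓ n
      extends  : s ⊑ target
      target⊆  : dom target ⊆ dom s ∪ A
      covers   : A ⊆ dom target
      property : P target

  Extension-⊑ : ∀ {P} → s ⊑ t → dom t ⊆ dom s ∪ A → Extension t A P → Extension s A P
  Extension-⊑ {s = s} {t = t} {A = A} s⊑t t⊆s∪A E = record
    { target   = target
    ; extends  = ⊑-trans s⊑t extends
    ; target⊆  = λ a∈ → [ t⊆s∪A , q⊆p∪q (dom s) A ] (x∈p∪q⁻ (dom t) A (target⊆ a∈))
    ; covers   = covers
    ; property = property
    }
    where open Extension E

  StepwiseExtendable : Subset ℓ → (PartialEmbedding ℓ n → Set) → Set
  StepwiseExtendable A P =
    ∀ s → P s → ∀ {x} → x ∈ A → x ∉ dom s → ∃[ w ] Σ (w ∉ range s) λ w∉ → P (s [ x ↦ w ]⟨ w∉ ⟩)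

  module _ (A : Subset ℓ) (P : PartialEmbedding ℓ n → Set) (step : StepwiseExtendable A P) where

    private
      Pending : PartialEmbedding ℓ n → List (Fin ℓ) → Set
      Pending s L = ∀ {a} → a ∈ A → a ∉ dom s → a ∈ₗ L

      pending-tail : ∀ {x L} → (∀ {a} → a ∉ dom t → a ∉ dom s) → (x ∈ A → x ∉ dom t → ⊥₀) →
                     Pending s (x ∷ L) → Pending t L
      pending-tail t-grows x-done pending a∈A a∉t with pending a∈A (t-grows a∉t)
      ... | Any.here refl = ⊥-elim (x-done a∈A a∉t)
      ... | Any.there a∈L = a∈L

    extend-along : ∀ L s → P s → Pending s L → Extension s A P
    extend-along [] s Ps pending = record
      { target   = s
      ; extends  = ⊑-refl
      ; target⊆  = p⊆p∪q A
      ; covers   = λ {a} a∈A → decidable-stable (a ∈? dom s) λ a∉ → case pending a∈A a∉ of λ ()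
      ; property = Ps
      }
    extend-along (x ∷ L) s Ps pending with x ∈? dom s | x ∈? A
    ... | yes x∈dom | _      =
      extend-along L s Ps (pending-tail {t = s} {s = s} id (λ _ x∉ → x∉ x∈dom) pending)
    ... | no  _     | no x∉A =
      extend-along L s Ps (pending-tail {t = s} {s = s} id (λ x∈A _ → x∉A x∈A) pending)
    ... | no  x∉dom | yes x∈A with step s Ps x∈A x∉dom
    ...   | w , w∉ , Pt = Extension-⊑ (⊑-↦ {s = s} x∉dom) (p∪⁅x⁆⊆p∪q x∈A)
      (extend-along L (s [ x ↦ w ]⟨ w∉ ⟩) Pt
        (pending-tail {t = s [ x ↦ w ]⟨ w∉ ⟩} {s = s} (λ a∉ a∈dom → a∉ (x∈p∪q⁺ (inj₁ a∈dom)))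
                      (λ _ x∉ → x∉ (x∈p∪q⁺ (inj₂ (x∈⁅x⁆ x)))) pending))

    extend-over : ∀ s → P s → Extension s A P
    extend-over s Ps = extend-along (allFin ℓ) s Ps λ {a} _ _ → ∈-allFin a

  EdgeExtension : PartialEmbedding ℓ n → Subset ℓ → Set
  EdgeExtension s e = Extension s e λ t → Edge G (image (φ t) e)

  embed-edge : ∀ s {e g} → ∣ e ∣ ≡ k → Edge G g → Template s e g → EdgeExtension s e
  embed-edge s {e} ∣e∣≡k g-edge template = record
    { target   = target
    ; extends  = extends
    ; target⊆  = target⊆
    ; covers   = covers
    ; property = image-edge property
    }
    where
    Guided : PartialEmbedding ℓ n → Set
    Guided t = ∃[ g ] Edge G g × Template t e g

    step : StepwiseExtendable e Guided
    step t (g , g-edge , template) {x} x∈e x∉dom =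
      vertex , fresh , edge , is-edge , template-↦ {s = t} {w∉ = fresh} X-template vertex∈edge λ a∈e _ → a∈e
      where
      ∣e∩dom∣<k : ∣ e ∩ dom t ∣ < k
      ∣e∩dom∣<k = <-≤-trans (p⊂q⇒∣p∣<∣q∣ (p∩q⊆p e (dom t) , x , x∈e , x∉dom ∘ proj₂ ∘ x∈p∩q⁻ e (dom t)))
                            (≤-reflexive ∣e∣≡k)
      open Growth (grow t e x∉dom ∣e∩dom∣<k g-edge template)

    open Extension (extend-over e Guided step s (_ , g-edge , template))

    image-edge : Guided target → Edge G (image (φ target) e)
    image-edge (g , g-edge , template) = subst (Edge G) (sym image≡g) g-edge
      where
      image≡g : image (φ target) e ≡ g
      image≡g = template⇒image≡ {s = target} covers template
                  (≤-reflexive (trans (uniform g g-edge) (sym ∣e∣≡k)))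

  module Sequential {m} (f : Fin m → Subset ℓ) (P : Fin ℓ → Set) where

    record Progress (i : ℕ) (s : PartialEmbedding ℓ n) : Set where
      field
        dom⊆     : ∀ {a} → a ∈ dom s → P a ⊎ Before f i a
        embedded : ∀ r → toℕ r < i → Embeds G s (f r)

    progress-start : ∀ {s} → (∀ {a} → a ∈ dom s → P a) → Progress 0 s
    progress-start dom⊆P = record { dom⊆ = inj₁ ∘ dom⊆P ; embedded = λ _ () }

    progress-step : ∀ {i s} → Progress i s → (r : Fin m) → toℕ r ≡ i → (E : EdgeExtension s (f r)) →
                    Progress (suc i) (Extension.target E)
    progress-step {s = s} progress r refl E = record { dom⊆ = dom⊆′ ; embedded = embedded′ }
      where
      open Extension E
      open Progress progress
      dom⊆′ : ∀ {a} → a ∈ dom target → P a ⊎ Before f (suc (toℕ r)) a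
      dom⊆′ a∈ with x∈p∪q⁻ (dom s) (f r) (target⊆ a∈)
      ... | inj₂ a∈fr = inj₂ (r , ≤-refl , a∈fr)
      ... | inj₁ a∈s with dom⊆ a∈s
      ...   | inj₁ Pa                  = inj₁ Pa
      ...   | inj₂ (r′ , r′<r , a∈fr′) = inj₂ (r′ , ≤-trans r′<r (n≤1+n _) , a∈fr′)
      embedded′ : ∀ r′ → toℕ r′ < suc (toℕ r) → Embeds G target (f r′)
      embedded′ r′ r′<1+r with m<1+n⇒m<n∨m≡n r′<1+r
      ... | inj₁ r′<r = Embeds-⊑ {G = G} extends (embedded r′ r′<r)
      ... | inj₂ r′≡r rewrite toℕ-injective r′≡r = covers , property

    progress-end : ∀ {s} → Progress m s → ∀ r → Embeds G s (f r)
    progress-end progress r = Progress.embedded progress r (toℕ<n r)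

  module GivenEdge {h : Subset n} (h-edge : Edge G h) (0<k : 0 < k) where

    h-vertex : ∃[ v ] v ∈ h
    h-vertex with ∣p∣<∣q∣⇒q⊈p {p = ⊥} {q = h} (subst₂ _<_ (sym (∣⊥∣≡0 n)) (sym (uniform h h-edge)) 0<k)
    ... | v , v∈h , _ = v , v∈h

    complete : ∀ {Q : Hypergraph ℓ} {m} {f : Fin m → Subset ℓ} → (∀ e → Edge Q e → ∃[ r ] f r ≡ e) →
               (∃[ s ] ∀ r → Embeds G s (f r)) → ContainsCopy G Q
    complete {Q} {f = f} onto (s , embeds) =
      φ target , (λ a b → injective target (covers ∈⊤) (covers ∈⊤)) , copy
      where
      step : StepwiseExtendable ⊤ (λ _ → ⊤₀)
      step t _ _ x∉dom = vertex , fresh , tt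
        where
        ∣⊥∩dom∣<k : ∣ ⊥ ∩ dom t ∣ < k
        ∣⊥∩dom∣<k = ≤-<-trans (∣p∩q∣≤∣p∣ ⊥ (dom t)) (subst (_< k) (sym (∣⊥∣≡0 ℓ)) 0<k)
        open Growth (grow t ⊥ x∉dom ∣⊥∩dom∣<k h-edge λ a∈⊥ → contradiction a∈⊥ ∉⊥)
      open Extension (extend-over ⊤ (λ _ → ⊤₀) step s tt)
      copy : ∀ e → Edge Q e → ∃[ g ] Edge G g × (∀ x → x ∈ g ⇔ (∃[ a ] a ∈ e × φ target a ≡ x))
      copy e e-edge with onto e e-edge
      ... | r , refl = image (φ target) (f r) , proj₂ (Embeds-⊑ {G = G} extends (embeds r)) , λ x →
        mk⇔ (∈-image⁻ (φ target) (f r)) λ { (a , a∈e , refl) → ∈-image⁺ (φ target) a∈e }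

    module Degenerate {m} (f : Fin m → Subset ℓ) (f-size : ∀ r → ∣ f r ∣ ≡ k)
                      (degenerate : DegenerateOrder f) where
      open Sequential f (λ _ → ⊥₀)

      template : ∀ {i s} → Progress i s → (r : Fin m) → toℕ r ≡ i → ∃[ g ] Edge G g × Template s (f r) g
      template {zero} progress r _ = h , h-edge , λ _ a∈dom → case Progress.dom⊆ progress a∈dom of λ
        { (inj₁ ())
        ; (inj₂ (_ , () , _))
        }
      template {suc i} {s} progress r r≡1+i with degenerate r (subst (1 ≤_) (sym r≡1+i) (s≤s z≤n))
      ... | j , j<r , closed =
        image (φ s) (f j) , proj₂ (Progress.embedded progress j (subst (toℕ j <_) r≡1+i j<r)) ,
        λ a∈fr a∈dom → ∈-image⁺ (φ s) (closed _ a∈fr (earlier a∈dom))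
        where
        earlier : ∀ {a} → a ∈ dom s → Before f (toℕ r) a
        earlier a∈dom with Progress.dom⊆ progress a∈dom
        ... | inj₂ before = subst (λ i → Before f i _) (sym r≡1+i) before

      advance : ∀ {i s} → Progress i s → i < m → Σ (PartialEmbedding ℓ n) (Progress (suc i))
      advance {i} {s} progress i<m = Extension.target E , progress-step progress r (toℕ-fromℕ< i<m) E
        where
        r : Fin m
        r = fromℕ< i<m
        E : EdgeExtension s (f r)
        E with template progress r (toℕ-fromℕ< i<m)
        ... | g , g-edge , g-template = embed-edge s (f-size r) g-edge g-template

      stage : ∀ i → i ≤ m → Σ (PartialEmbedding ℓ n) (Progress i)
      stage zero    _   = ∅-embedding (proj₁ h-vertex) , progress-start λ a∈⊥ → ∉⊥ a∈⊥
      stage (suc i) i<m = advance (proj₂ (stage i (<⇒≤ i<m))) i<m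

      embeds-all : ∃[ s ] ∀ r → Embeds G s (f r)
      embeds-all = let s , progress = stage m ≤-refl in s , progress-end progress

    module Cycle (2<k : 2 < k) {m₁} (2≤m₁ : 2 ≤ m₁) (f : Fin (suc m₁) → Subset ℓ) (f-size : ∀ r → ∣ f r ∣ ≡ k)
                 (linear : ConsecutiveShareOne f) (disjoint : NonConsecutiveDisjoint f)
                 (two-edges : AtMostTwoEdges f) where
      open LinearCycleStructure 2≤m₁ f linear disjoint two-edges
      open Sequential f (_≡ pivot)

      -- The anchor is the edge from which the closing edge f m₁ is finally embedded.
      record Stage (i : ℕ) .(i<m : i < suc m₁) (s : PartialEmbedding ℓ n) : Set where
        field
          progress        : Progress i s
          pivot∈dom       : pivot ∈ dom s
          prev            : Fin ℓ
          anchor          : Subset n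
          anchor-edge     : Edge G anchor
          anchor-template : Template s (⁅ prev ⁆ ∪ ⁅ pivot ⁆) anchor
          meets           : ∀ {a} → a ∈ f (at i i<m) → a ∈ dom s → a ∈ ⁅ prev ⁆ ∪ ⁅ pivot ⁆

      start : Σ (PartialEmbedding ℓ n) (Stage 0 (s≤s z≤n))
      start = ⁅ pivot ↦ proj₁ h-vertex ⁆ , record
        { progress        = progress-start (x∈⁅y⁆⇒x≡y pivot)
        ; pivot∈dom       = x∈⁅x⁆ pivot
        ; prev            = pivot
        ; anchor          = h
        ; anchor-edge     = h-edge
        ; anchor-template = λ _ _ → proj₂ h-vertex
        ; meets           = λ _ a∈dom → q⊆p∪q ⁅ pivot ⁆ ⁅ pivot ⁆ a∈dom
        }

      step : ∀ {i s} (1+i<m : suc i < suc m₁) → Stage i (<⇒≤ 1+i<m) s →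
             Σ (PartialEmbedding ℓ n) (Stage (suc i) 1+i<m)
      step {i} {s} 1+i<m stage = Extension.target E , record
        { progress        = progress′
        ; pivot∈dom       = dom-⊆ (Extension.extends E) pivot∈dom
        ; prev            = shared
        ; anchor          = edge
        ; anchor-edge     = is-edge
        ; anchor-template = template-⊑ (Extension.extends E₁) in-dom₁
                              (template-↦ {s = s} {w∉ = fresh} X-template vertex∈edge old⊆X)
        ; meets           = λ a∈next a∈dom → link-meets-next i 1+i<m a∈next (Progress.dom⊆ progress′ a∈dom)
        }
        where
        open Stage stage
        open Link (link i 1+i<m)
        this : Fin (suc m₁)
        this = at i (<⇒≤ 1+i<m)
        shared∉dom : shared ∉ dom s
        shared∉dom shared∈ = link-new i 1+i<m (Progress.dom⊆ progress shared∈)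
        X : Subset ℓ
        X = ⁅ prev ⁆ ∪ ⁅ pivot ⁆
        ∣X∩dom∣<k : ∣ X ∩ dom s ∣ < k
        ∣X∩dom∣<k = ≤-<-trans (∣p∩q∣≤∣p∣ X (dom s)) (≤-<-trans (∣p∪q∣≤∣p∣+∣q∣ ⁅ prev ⁆ ⁅ pivot ⁆)
                      (subst₂ (λ a b → a + b < k) (sym (∣⁅x⁆∣≡1 prev)) (sym (∣⁅x⁆∣≡1 pivot)) 2<k))
        open Growth (grow s X shared∉dom ∣X∩dom∣<k anchor-edge anchor-template)
        s₁ : PartialEmbedding ℓ n
        s₁ = s [ shared ↦ vertex ]⟨ fresh ⟩
        E₁ : EdgeExtension s₁ (f this)
        E₁ = embed-edge s₁ {g = edge} (f-size this) is-edge
               (template-↦ {s = s} {w∉ = fresh} X-template vertex∈edge meets)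
        E : EdgeExtension s (f this)
        E = Extension-⊑ (⊑-↦ {s = s} shared∉dom) (p∪⁅x⁆⊆p∪q shared∈this) E₁
        progress′ : Progress (suc i) (Extension.target E)
        progress′ = progress-step progress this (toℕ-fromℕ< (<⇒≤ 1+i<m)) E
        in-dom₁ : ∀ {a} → a ∈ ⁅ shared ⁆ ∪ ⁅ pivot ⁆ → a ∈ dom (Extension.target E₁) → a ∈ dom s₁
        in-dom₁ a∈ _ = [ (λ { refl → x∈p∪q⁺ (inj₂ (x∈⁅x⁆ shared)) })
                       , (λ { refl → x∈p∪q⁺ (inj₁ pivot∈dom) }) ] (∈⁅x⁆∪⁅y⁆⁻ a∈)
        old⊆X : ∀ {a} → a ∈ ⁅ shared ⁆ ∪ ⁅ pivot ⁆ → a ∈ dom s → a ∈ X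
        old⊆X a∈ a∈dom = [ (λ { refl → contradiction a∈dom shared∉dom })
                         , (λ { refl → q⊆p∪q ⁅ prev ⁆ ⁅ pivot ⁆ (x∈⁅x⁆ pivot) }) ] (∈⁅x⁆∪⁅y⁆⁻ a∈)

      stage : ∀ i (i<m : i < suc m₁) → Σ (PartialEmbedding ℓ n) (Stage i i<m)
      stage zero    _     = start
      stage (suc i) 1+i<m = step 1+i<m (proj₂ (stage i (<⇒≤ 1+i<m)))

      finish : ∀ {s} → Stage m₁ ≤-refl s → Σ (PartialEmbedding ℓ n) (Progress (suc m₁))
      finish {s} stage = Extension.target E , progress-step progress last (toℕ-fromℕ< ≤-refl) E
        where
        open Stage stage
        E : EdgeExtension s (f last)
        E = embed-edge s {g = anchor} (f-size last) anchor-edge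
              λ a∈ a∈dom → anchor-template (meets a∈ a∈dom) a∈dom

      embeds-all : ∃[ s ] ∀ r → Embeds G s (f r)
      embeds-all = let s , progress = finish (proj₂ (stage m₁ ≤-refl)) in s , progress-end progress

lemma3p4 : (k ℓ : ℕ) → k ≥ 3 → (Q : Hypergraph ℓ) → Uniform k Q →
    EdgeDegenerate Q ⊎ LinearCycle Q →
    ∀ {n} (G : Hypergraph n) → Uniform k G → Full k ℓ G → HasEdge G →
    ContainsCopy G Q
lemma3p4 k ℓ k≥3 Q uQ (inj₁ (m , f , (_ , f-edge , f-onto) , degenerate)) G uG full (h , h-edge) =
  complete f-onto embeds-all
  where
  open Embedding G uG full
  open GivenEdge h-edge (m<n⇒0<n k≥3)
  open Degenerate f (λ r → uQ (f r) (f-edge r)) degenerate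
lemma3p4 k ℓ k≥3 Q uQ
         (inj₂ (suc m₁ , f , s≤s 2≤m₁ , (_ , f-edge , f-onto) , linear , disjoint , two-edges , _))
         G uG full (h , h-edge) =
  complete f-onto embeds-all
  where
  open Embedding G uG full
  open GivenEdge h-edge (m<n⇒0<n k≥3)
  open Cycle k≥3 2≤m₁ f (λ r → uQ (f r) (f-edge r)) linear disjoint two-edges
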